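{- Let $d\ge0$ be an integer and let $0\le n\le d$. Then the $n$-fold iterate $T_1^n$ is defined on $\triangle^G_d$ and is a bijection (one-to-one and onto) from $\triangle^G_d$ to $\triangle^G_{d-n}\cap\{(\lambda_1,\dots,\lambda_m)\times[k_1,\dots,k_m]: nk_1<k_m\}$.
   Context: A partition is written $(\lambda_1,\dots,\lambda_m)\times[k_1,\dots,k_m]$, where $m\ge1$, the parts $\lambda_i$ are integers with $\lambda_1>\dots>\lambda_m>0$ and the multiplicities $k_i$ are positive integers; $m$ is its dimension. For an integer $j\ge0$, $\triangle^G_j$ is the set of partitions of dimension $m\ge2$ with $\lambda_1-\lambda_2-j\lambda_m>0>\lambda_1-\lambda_2-(j+1)\lambda_m$ (for $m=2$, $\lambda_m=\lambda_2$). $\triangle_1$ is the set of partitions of dimension $m\ge2$ with $\lambda_1>\lambda_2+\lambda_m$, and $T_1:\triangle_1\to$ partitions is $T_1(\lambda)=(\lambda_1-\lambda_m,\lambda_2,\dots,\lambda_m)\times[k_1,\dots,k_{m-1},k_1+k_m]$ (for $m=2$: $(\lambda_1-\lambda_2,\lambda_2)\times[k_1,k_1+k_2]$); $T_1^0$ is the identity. -}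

module Defs where

open import Data.Nat using (ℕ; zero; suc; _+_; _*_; _∸_; _<_)
open import Data.Product using (_×_; _,_; proj₁; proj₂)
open import Data.List using (List; []; _∷_)
open import Data.List.Relation.Unary.All using (All)
open import Data.List.Relation.Unary.Linked using (Linked)
open import Data.Unit using (⊤)
open import Data.Empty using (⊥)

-- A (raw) partition (λ₁,…,λₘ)×[k₁,…,kₘ] is represented as the list
-- of pairs (λᵢ , kᵢ) in order i = 1,…,m; its dimension is the length.
Part : Set
Part = List (ℕ × ℕ)

NonEmpty : Part → Set
NonEmpty []      = ⊥
NonEmpty (_ ∷ _) = ⊤

IsPartition : Part → Set
IsPartition p =
  NonEmpty p
  × Linked (λ a b → proj₁ b < proj₁ a) p
  × All (λ a → 0 < proj₁ a) p
  × All (λ a → 0 < proj₂ a) p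

lastOf : ℕ × ℕ → Part → ℕ × ℕ
lastOf x []       = x
lastOf _ (y ∷ ys) = lastOf y ys

mapLast : (ℕ × ℕ → ℕ × ℕ) → Part → Part
mapLast f []           = []
mapLast f (x ∷ [])     = f x ∷ []
mapLast f (x ∷ y ∷ ys) = x ∷ mapLast f (y ∷ ys)

-- k₁ and kₘ (0 for the empty list, never used on partitions)
firstMult : Part → ℕ
firstMult []            = 0
firstMult ((_ , k) ∷ _) = k

lastMult : Part → ℕ
lastMult []       = 0
lastMult (x ∷ xs) = proj₂ (lastOf x xs)

-- △^G_j : dimension m ≥ 2 and  λ₁ - λ₂ - jλₘ > 0 > λ₁ - λ₂ - (j+1)λₘ
-- (written additively over ℕ)
TriG : ℕ → Part → Set
TriG j []                               = ⊥
TriG j (_ ∷ [])                         = ⊥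
TriG j p@((l₁ , _) ∷ (l₂ , k₂) ∷ rest) =
  IsPartition p
  × (l₂ + j * proj₁ (lastOf (l₂ , k₂) rest) < l₁)
  × (l₁ < l₂ + suc j * proj₁ (lastOf (l₂ , k₂) rest))

Tri1 : Part → Set
Tri1 []                               = ⊥
Tri1 (_ ∷ [])                         = ⊥
Tri1 p@((l₁ , _) ∷ (l₂ , k₂) ∷ rest) =
  IsPartition p × (l₂ + proj₁ (lastOf (l₂ , k₂) rest) < l₁)

-- T₁(λ) = (λ₁-λₘ,λ₂,…,λₘ)×[k₁,…,k_{m-1},k₁+kₘ]
-- (the raw operation is total; it is only meaningful on △₁)
T1 : Part → Part
T1 []                       = []
T1 ((l₁ , k₁) ∷ [])         = (l₁ , k₁) ∷ []
T1 ((l₁ , k₁) ∷ x ∷ xs)     =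
  (l₁ ∸ proj₁ (lastOf x xs) , k₁)
    ∷ mapLast (λ a → (proj₁ a , k₁ + proj₂ a)) (x ∷ xs)

T1^ : ℕ → Part → Part
T1^ zero    p = p
T1^ (suc n) p = T1 (T1^ n p)

-- T₁ⁿ is defined at p: each of the n successive applications of T₁
-- is to an element of its domain △₁
T1^Defined : ℕ → Part → Set
T1^Defined n p = ∀ i → i < n → Tri1 (T1^ i p)

{-# OPTIONS --safe #-}
module Submission where

open import Defs
open import Data.Nat using (ℕ; zero; suc; _+_; _*_; _∸_; _<_; _≤_; z≤n; >-nonZero)
open import Data.Nat.Properties
open import Data.Nat.Tactic.RingSolver using (solve-∀)
open import Data.Product using (_×_; Σ; _,_; proj₁; proj₂)
open import Data.List using ([]; _∷_; _∷ʳ_)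
open import Data.List.Properties using (∷-injective; ∷ʳ-injective)
open import Data.List.Relation.Unary.All using ([]; _∷_)
open import Data.List.Relation.Unary.All.Properties using (∷ʳ⁻)
open import Data.List.Relation.Unary.Linked using ([-]; _∷_)
open import Relation.Binary.PropositionalEquality

-- Writing a partition of dimension ≥ 2 as (λ₁ , k₁) ∷ middle ∷ʳ (λₘ , kₘ),
-- T₁ⁿ only changes the two ends: λ₁ ↦ λ₁ - nλₘ and kₘ ↦ kₘ + nk₁.  The
-- middle and λₘ are untouched, so λ₂ is unchanged and the window
-- λ₂ + dλₘ < λ₁ < λ₂ + (d+1)λₘ cutting out △^G_d moves down to the
-- window of △^G_{d-n}; the partition conditions survive because kₘ grows.
-- Conversely λ₁ ↦ λ₁ + nλₘ, kₘ ↦ kₘ - nk₁ is an inverse, defined on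
-- partitions exactly when nk₁ < kₘ.

record Shape : Set where
  constructor shape
  field
    l₁ k₁  : ℕ
    middle : Part
    lₘ kₘ  : ℕ

open Shape

toPart : Shape → Part
toPart (shape l₁ k₁ ys lₘ kₘ) = (l₁ , k₁) ∷ ys ∷ʳ (lₘ , kₘ)

-- λ₂ of a shape with middle ys and last part lₘ
firstPart : Part → ℕ → ℕ
firstPart []      lₘ = lₘ
firstPart (y ∷ _) _  = proj₁ y

toPart-surjective : ∀ a b rest → Σ Shape λ s → toPart s ≡ a ∷ b ∷ rest
toPart-surjective a b [] = shape (proj₁ a) (proj₂ a) [] (proj₁ b) (proj₂ b) , refl
toPart-surjective a b (c ∷ rest) with toPart-surjective b c rest
... | shape l k ys lₘ kₘ , eq = shape (proj₁ a) (proj₂ a) ((l , k) ∷ ys) lₘ kₘ , cong (a ∷_) eq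

toPart-injective : ∀ {s s′} → toPart s ≡ toPart s′ → s ≡ s′
toPart-injective {shape _ _ ys _ _} {shape _ _ ys′ _ _} eq with ∷-injective eq
... | refl , tails with ∷ʳ-injective ys ys′ tails
... | refl , refl = refl

lastOf-∷ʳ : ∀ x ys z → lastOf x (ys ∷ʳ z) ≡ z
lastOf-∷ʳ x []       z = refl
lastOf-∷ʳ x (y ∷ ys) z = lastOf-∷ʳ y ys z

mapLast-∷ʳ : ∀ f ys z → mapLast f (ys ∷ʳ z) ≡ ys ∷ʳ f z
mapLast-∷ʳ f []           z = refl
mapLast-∷ʳ f (y ∷ [])     z = refl
mapLast-∷ʳ f (y ∷ y′ ∷ ys) z = cong (y ∷_) (mapLast-∷ʳ f (y′ ∷ ys) z)

lastMult-toPart : ∀ s → lastMult (toPart s) ≡ kₘ s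
lastMult-toPart (shape l₁ k₁ ys lₘ kₘ) = cong proj₂ (lastOf-∷ʳ (l₁ , k₁) ys (lₘ , kₘ))

IsPartition-∷⁺ : ∀ {a} ys {z} → IsPartition (ys ∷ʳ z) →
  firstPart ys (proj₁ z) < proj₁ a → 0 < proj₂ a → IsPartition (a ∷ ys ∷ʳ z)
IsPartition-∷⁺ []      (_ , l , p₁ , p₂) lt k = _ , lt ∷ l , ≤-<-trans z≤n lt ∷ p₁ , k ∷ p₂
IsPartition-∷⁺ (_ ∷ _) (_ , l , p₁ , p₂) lt k = _ , lt ∷ l , ≤-<-trans z≤n lt ∷ p₁ , k ∷ p₂

IsPartition-∷⁻ : ∀ {a} ys {z} → IsPartition (a ∷ ys ∷ʳ z) →
  IsPartition (ys ∷ʳ z) × firstPart ys (proj₁ z) < proj₁ a × 0 < proj₂ a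
IsPartition-∷⁻ []      (_ , lt ∷ l , _ ∷ p₁ , k ∷ p₂) = (_ , l , p₁ , p₂) , lt , k
IsPartition-∷⁻ (_ ∷ _) (_ , lt ∷ l , _ ∷ p₁ , k ∷ p₂) = (_ , l , p₁ , p₂) , lt , k

IsPartition-∷ʳ-mult : ∀ ys {l k k′} → IsPartition (ys ∷ʳ (l , k)) → 0 < k′ →
  IsPartition (ys ∷ʳ (l , k′))
IsPartition-∷ʳ-mult []       (_ , _ , l>0 ∷ [] , _) k′>0 = _ , [-] , l>0 ∷ [] , k′>0 ∷ []
IsPartition-∷ʳ-mult (y ∷ ys) p k′>0 with IsPartition-∷⁻ ys p
... | p′ , lt , k>0 = IsPartition-∷⁺ ys (IsPartition-∷ʳ-mult ys p′ k′>0) lt k>0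

IsPartition-reshape : ∀ {l₁ l₁′ k₁ ys lₘ kₘ kₘ′} →
  IsPartition (toPart (shape l₁ k₁ ys lₘ kₘ)) → firstPart ys lₘ < l₁′ → 0 < kₘ′ →
  IsPartition (toPart (shape l₁′ k₁ ys lₘ kₘ′))
IsPartition-reshape {ys = ys} p lt kₘ′>0 with IsPartition-∷⁻ ys p
... | tail , _ , k₁>0 = IsPartition-∷⁺ ys (IsPartition-∷ʳ-mult ys tail kₘ′>0) lt k₁>0

IsPartition⇒kₘ>0 : ∀ s → IsPartition (toPart s) → 0 < kₘ s
IsPartition⇒kₘ>0 (shape _ _ ys _ _) (_ , _ , _ , _ ∷ p₂) = proj₂ (∷ʳ⁻ {xs = ys} p₂)

Window : ℕ → ℕ → ℕ → ℕ → Set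
Window d a l x = (a + d * l < x) × (x < a + suc d * l)

Window⇒> : ∀ {d a l x} → Window d a l x → a < x
Window⇒> (lo , _) = ≤-<-trans (m≤m+n _ _) lo

+*-shift : ∀ a l n e → a + (n + e) * l ≡ n * l + (a + e * l)
+*-shift = solve-∀

+suc*-shift : ∀ a l n e → a + suc (n + e) * l ≡ n * l + (a + suc e * l)
+suc*-shift = solve-∀

Window-+⁺ : ∀ n {e a l x} → Window e a l x → Window (n + e) a l (n * l + x)
Window-+⁺ n {e} {a} {l} {x} (lo , hi) =
  subst (_< n * l + x) (sym (+*-shift a l n e)) (+-monoʳ-< (n * l) lo) ,
  subst (n * l + x <_) (sym (+suc*-shift a l n e)) (+-monoʳ-< (n * l) hi)

Window-+⁻ : ∀ n {e a l x} → Window (n + e) a l (n * l + x) → Window e a l x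
Window-+⁻ n {e} {a} {l} {x} (lo , hi) =
  +-cancelˡ-< (n * l) _ _ (subst (_< n * l + x) (+*-shift a l n e) lo) ,
  +-cancelˡ-< (n * l) _ _ (subst (n * l + x <_) (+suc*-shift a l n e) hi)

Window⇒≤ : ∀ {n d a l y} → n ≤ d → Window d a l y → n * l ≤ y
Window⇒≤ {n} {d} {a} {l} {y} n≤d (lo , _) = begin
  n * l                     ≤⟨ m≤m+n (n * l) _ ⟩
  n * l + (a + (d ∸ n) * l) ≡⟨ +*-shift a l n (d ∸ n) ⟨
  a + (n + (d ∸ n)) * l     ≡⟨ cong (λ m → a + m * l) (m+[n∸m]≡n n≤d) ⟩
  a + d * l                 <⟨ lo ⟩
  y                         ∎
  where open ≤-Reasoning

Window-∸ : ∀ {n d a l y} → n ≤ d → Window d a l y → Window (d ∸ n) a l (y ∸ n * l)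
Window-∸ {n} {a = a} {l} n≤d w =
  Window-+⁻ n (subst₂ (λ d y → Window d a l y) (sym (m+[n∸m]≡n n≤d)) (sym (m+[n∸m]≡n (Window⇒≤ n≤d w))) w)

Window-+ : ∀ {n d a l x} → n ≤ d → Window (d ∸ n) a l x → Window d a l (n * l + x)
Window-+ {n} {a = a} {l} n≤d w = subst (λ d → Window d a l _) (m+[n∸m]≡n n≤d) (Window-+⁺ n w)

InWindow : ℕ → Shape → Set
InWindow d (shape l₁ _ ys lₘ _) = Window d (firstPart ys lₘ) lₘ l₁

TriG-toPart : ∀ d s → TriG d (toPart s) ≡ (IsPartition (toPart s) × InWindow d s)
TriG-toPart d (shape l₁ k₁ []       lₘ kₘ) = refl
TriG-toPart d (shape l₁ k₁ (y ∷ ys) lₘ kₘ) rewrite lastOf-∷ʳ y ys (lₘ , kₘ) = refl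

TriG-toPart⁻ : ∀ {d} s → TriG d (toPart s) → IsPartition (toPart s) × InWindow d s
TriG-toPart⁻ {d} s = subst (λ A → A) (TriG-toPart d s)

TriG-toPart⁺ : ∀ {d} s → IsPartition (toPart s) × InWindow d s → TriG d (toPart s)
TriG-toPart⁺ {d} s = subst (λ A → A) (sym (TriG-toPart d s))

TriG⇒toPart : ∀ {d} p → TriG d p → Σ Shape λ s → toPart s ≡ p
TriG⇒toPart (a ∷ b ∷ rest) _ = toPart-surjective a b rest

TriG⇒Tri1 : ∀ {d} p → 0 < d → TriG d p → Tri1 p
TriG⇒Tri1 {d} ((l₁ , _) ∷ (l₂ , k₂) ∷ rest) d>0 (isPart , lo , _) =
  isPart , ≤-<-trans (+-monoʳ-≤ l₂ (m≤n*m (proj₁ (lastOf (l₂ , k₂) rest)) d ⦃ >-nonZero d>0 ⦄)) lo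

T1^ₛ : ℕ → Shape → Shape
T1^ₛ n (shape l₁ k₁ ys lₘ kₘ) = shape (l₁ ∸ n * lₘ) k₁ ys lₘ (n * k₁ + kₘ)

T1^ₛ⁻¹ : ℕ → Shape → Shape
T1^ₛ⁻¹ n (shape l₁ k₁ ys lₘ kₘ) = shape (n * lₘ + l₁) k₁ ys lₘ (kₘ ∸ n * k₁)

T1^ₛ⁻¹-T1^ₛ : ∀ n s → n * lₘ s ≤ l₁ s → T1^ₛ⁻¹ n (T1^ₛ n s) ≡ s
T1^ₛ⁻¹-T1^ₛ n (shape l₁ k₁ ys lₘ kₘ) nlₘ≤l₁ =
  cong₂ (λ l k → shape l k₁ ys lₘ k) (m+[n∸m]≡n nlₘ≤l₁) (m+n∸m≡n (n * k₁) kₘ)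

T1^ₛ-T1^ₛ⁻¹ : ∀ n s → n * k₁ s ≤ kₘ s → T1^ₛ n (T1^ₛ⁻¹ n s) ≡ s
T1^ₛ-T1^ₛ⁻¹ n (shape l₁ k₁ ys lₘ kₘ) nk₁≤kₘ =
  cong₂ (λ l k → shape l k₁ ys lₘ k) (m+n∸m≡n (n * lₘ) l₁) (m+[n∸m]≡n nk₁≤kₘ)

T1-toPart : ∀ l₁ k₁ ys lₘ kₘ →
  T1 (toPart (shape l₁ k₁ ys lₘ kₘ)) ≡ toPart (shape (l₁ ∸ lₘ) k₁ ys lₘ (k₁ + kₘ))
T1-toPart l₁ k₁ []       lₘ kₘ = refl
T1-toPart l₁ k₁ (y ∷ ys) lₘ kₘ
  rewrite lastOf-∷ʳ y ys (lₘ , kₘ) | mapLast-∷ʳ (λ a → proj₁ a , k₁ + proj₂ a) (y ∷ ys) (lₘ , kₘ) = refl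

T1^-toPart : ∀ n s → T1^ n (toPart s) ≡ toPart (T1^ₛ n s)
T1^-toPart zero    (shape l₁ k₁ ys lₘ kₘ) = refl
T1^-toPart (suc n) s@(shape l₁ k₁ ys lₘ kₘ) = begin
  T1 (T1^ n (toPart s))
    ≡⟨ cong T1 (T1^-toPart n s) ⟩
  T1 (toPart (T1^ₛ n s))
    ≡⟨ T1-toPart (l₁ ∸ n * lₘ) k₁ ys lₘ (n * k₁ + kₘ) ⟩
  toPart (shape (l₁ ∸ n * lₘ ∸ lₘ) k₁ ys lₘ (k₁ + (n * k₁ + kₘ)))
    ≡⟨ cong₂ (λ l k → toPart (shape l k₁ ys lₘ k)) l₁≡ (sym (+-assoc k₁ (n * k₁) kₘ)) ⟩
  toPart (T1^ₛ (suc n) s)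
    ∎
  where
  open ≡-Reasoning
  l₁≡ : l₁ ∸ n * lₘ ∸ lₘ ≡ l₁ ∸ (lₘ + n * lₘ)
  l₁≡ = trans (∸-+-assoc l₁ (n * lₘ) lₘ) (cong (l₁ ∸_) (+-comm (n * lₘ) lₘ))

T1^ₛ-lastMult : ∀ n s → IsPartition (toPart s) → n * k₁ s < lastMult (toPart (T1^ₛ n s))
T1^ₛ-lastMult n s p =
  subst (n * k₁ s <_) (sym (lastMult-toPart (T1^ₛ n s))) (m<m+n (n * k₁ s) (IsPartition⇒kₘ>0 s p))

TriG-T1^ₛ : ∀ {n d} s → n ≤ d → TriG d (toPart s) → TriG (d ∸ n) (toPart (T1^ₛ n s))
TriG-T1^ₛ {n} {d} s@(shape l₁ k₁ ys lₘ kₘ) n≤d t with TriG-toPart⁻ s t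
... | p , w = TriG-toPart⁺ (T1^ₛ n s) (IsPartition-reshape p (Window⇒> {d ∸ n} {l = lₘ} w′) kₘ′>0 , w′)
  where
  w′ : InWindow (d ∸ n) (T1^ₛ n s)
  w′ = Window-∸ n≤d w
  kₘ′>0 : 0 < n * k₁ + kₘ
  kₘ′>0 = <-≤-trans (IsPartition⇒kₘ>0 s p) (m≤n+m kₘ (n * k₁))

TriG-T1^ₛ⁻¹ : ∀ {n d} s → n ≤ d → n * k₁ s < kₘ s →
  TriG (d ∸ n) (toPart s) → TriG d (toPart (T1^ₛ⁻¹ n s))
TriG-T1^ₛ⁻¹ {n} {d} s@(shape l₁ k₁ ys lₘ kₘ) n≤d nk₁<kₘ t with TriG-toPart⁻ s t
... | p , w = TriG-toPart⁺ (T1^ₛ⁻¹ n s) (IsPartition-reshape p (Window⇒> {d} {l = lₘ} w′) (m<n⇒0<n∸m nk₁<kₘ) , w′)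
  where
  w′ : InWindow d (T1^ₛ⁻¹ n s)
  w′ = Window-+ n≤d w

TriG⇒n*lₘ≤l₁ : ∀ {n d} s → n ≤ d → TriG d (toPart s) → n * lₘ s ≤ l₁ s
TriG⇒n*lₘ≤l₁ s@(shape _ _ _ _ _) n≤d t = Window⇒≤ n≤d (proj₂ (TriG-toPart⁻ s t))

T1^ₛ-injective : ∀ {n d} s s′ → n ≤ d → TriG d (toPart s) → TriG d (toPart s′) →
  T1^ₛ n s ≡ T1^ₛ n s′ → s ≡ s′
T1^ₛ-injective {n} s s′ n≤d t t′ eq = begin
  s                    ≡⟨ T1^ₛ⁻¹-T1^ₛ n s (TriG⇒n*lₘ≤l₁ s n≤d t) ⟨
  T1^ₛ⁻¹ n (T1^ₛ n s)  ≡⟨ cong (T1^ₛ⁻¹ n) eq ⟩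
  T1^ₛ⁻¹ n (T1^ₛ n s′) ≡⟨ T1^ₛ⁻¹-T1^ₛ n s′ (TriG⇒n*lₘ≤l₁ s′ n≤d t′) ⟩
  s′                   ∎
  where open ≡-Reasoning

mainTheorem10 : (d n : ℕ) → n ≤ d →
    ((p : Part) → TriG d p → T1^Defined n p)
    × ((p : Part) → TriG d p →
    TriG (d ∸ n) (T1^ n p) × (n * firstMult (T1^ n p) < lastMult (T1^ n p)))
    × ((p q : Part) → TriG d p → TriG d q → T1^ n p ≡ T1^ n q → p ≡ q)
    × ((q : Part) → TriG (d ∸ n) q → n * firstMult q < lastMult q →
    Σ Part (λ p → TriG d p × T1^ n p ≡ q))
mainTheorem10 d n n≤d = defined , mapsInto , injective , surjective
  where
  defined : (p : Part) → TriG d p → T1^Defined n p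
  defined p t i i<n with TriG⇒toPart p t
  ... | s , refl = subst Tri1 (sym (T1^-toPart i s))
                     (TriG⇒Tri1 _ (m<n⇒0<n∸m i<d) (TriG-T1^ₛ s (<⇒≤ i<d) t))
    where i<d = <-≤-trans i<n n≤d

  mapsInto : (p : Part) → TriG d p →
    TriG (d ∸ n) (T1^ n p) × (n * firstMult (T1^ n p) < lastMult (T1^ n p))
  mapsInto p t with TriG⇒toPart p t
  ... | s , refl rewrite T1^-toPart n s =
    TriG-T1^ₛ s n≤d t , T1^ₛ-lastMult n s (proj₁ (TriG-toPart⁻ s t))

  injective : (p q : Part) → TriG d p → TriG d q → T1^ n p ≡ T1^ n q → p ≡ q
  injective p q tp tq eq with TriG⇒toPart p tp | TriG⇒toPart q tq
  ... | s , refl | s′ , refl = cong toPart (T1^ₛ-injective s s′ n≤d tp tq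
    (toPart-injective (trans (sym (T1^-toPart n s)) (trans eq (T1^-toPart n s′)))))

  surjective : (q : Part) → TriG (d ∸ n) q → n * firstMult q < lastMult q →
    Σ Part (λ p → TriG d p × T1^ n p ≡ q)
  surjective q t lt with TriG⇒toPart q t
  ... | s , refl = toPart (T1^ₛ⁻¹ n s) , TriG-T1^ₛ⁻¹ s n≤d nk₁<kₘ t ,
    trans (T1^-toPart n _) (cong toPart (T1^ₛ-T1^ₛ⁻¹ n s (<⇒≤ nk₁<kₘ)))
    where nk₁<kₘ = subst (n * k₁ s <_) (lastMult-toPart s) lt
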